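{- Let $1\le k\le d$. For every $n\ge1$, the number of closed $(d,k)$ self-avoiding manifolds of $k$-area $n$ satisfies $$c^{\mathrm{SAM}}_{(d,k),n}(h=0)\le\binom{d}{k}\big(2(d-k)+1\big)^{n-1}.$$
   Context: A $k$-face of $\mathbb{Z}^d$ is a set $\{x\in\mathbb{R}^d:|x_i-b_i|\le\frac12\ (i\in H),\ x_i=b_i\ (i\notin H)\}$ with $|H|=k$, $b_i\in\mathbb{Z}+\frac12$ for $i\in H$, $b_i\in\mathbb{Z}$ otherwise; $(k-1)$-faces analogously. A closed $(d,k)$ self-avoiding manifold of $k$-area $n$ is a set $\Sigma$ of $n$ $k$-faces such that every $(k-1)$-face contained in some element of $\Sigma$ lies in exactly two elements of $\Sigma$, and the graph joining faces sharing a $(k-1)$-face is connected. These are identified up to translation by $\mathbb{Z}^d$; $c^{\mathrm{SAM}}_{(d,k),n}(h=0)$ is their number. -}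

module Defs where

open import Data.Nat using (ℕ; suc)
open import Data.Integer as ℤ using (ℤ; +_)
open import Data.Fin using (Fin)
open import Data.Fin.Subset using (Subset; _∈_; _-_; ∣_∣)
open import Data.Vec using (Vec; lookup; zipWith)
open import Data.Product using (Σ; ∃; ∃-syntax; _×_; _,_)
open import Data.Sum using (_⊎_)
open import Data.List using (List; length)
import Data.List.Membership.Propositional as LM
open import Data.List.Relation.Unary.All using (All)
open import Data.List.Relation.Unary.Unique.Propositional using (Unique)
open import Relation.Binary.PropositionalEquality using (_≡_; _≢_)
open import Relation.Nullary using (¬_)
open import Function.Bundles using (_⇔_)

-- A cubical face of ℤ^d, given by its set of free directions H and its
-- lower corner a ∈ ℤ^d:
--   { x : a_i ≤ x_i ≤ a_i + 1 (i ∈ H),  x_i = a_i (i ∉ H) }.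
-- (In the paper's notation b_i = a_i + 1/2 for i ∈ H, b_i = a_i otherwise;
-- this is a bijection, so faces and such pairs correspond exactly.)
-- Its dimension is ∣ H ∣.
Face : ℕ → Set
Face d = Subset d × Vec ℤ d

dim : ∀ {d} → Face d → ℕ
dim (H , _) = ∣ H ∣

FacetOf : ∀ {d} → Face d → Face d → Set
FacetOf {d} (G , c) (H , a) =
  ∃[ j ] (j ∈ H × G ≡ H - j
         × (∀ (i : Fin d) → i ≢ j → lookup c i ≡ lookup a i)
         × (lookup c j ≡ lookup a j ⊎ lookup c j ≡ lookup a j ℤ.+ + 1))

-- A finite set of faces is represented by a duplicate-free list.
module _ {d : ℕ} where
  open LM {A = Face d} using () renaming (_∈_ to _∈L_)

  Closed : List (Face d) → Set
  Closed S = ∀ (g : Face d) → (∃[ f ] (f ∈L S × FacetOf g f)) →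
    ∃[ f₁ ] ∃[ f₂ ] (f₁ ∈L S × f₂ ∈L S × f₁ ≢ f₂ × FacetOf g f₁ × FacetOf g f₂
      × (∀ f → f ∈L S → FacetOf g f → f ≡ f₁ ⊎ f ≡ f₂))

  Adjacent : Face d → Face d → Set
  Adjacent f f′ = ∃[ g ] (FacetOf g f × FacetOf g f′)

  data Path (S : List (Face d)) : Face d → Face d → Set where
    here : ∀ {f} → Path S f f
    step : ∀ {f f′ f″} → f′ ∈L S → Adjacent f f′ → Path S f′ f″ → Path S f f″

  Connected : List (Face d) → Set
  Connected S = ∀ f f′ → f ∈L S → f′ ∈L S → Path S f f′

  IsClosedSAM : (k n : ℕ) → List (Face d) → Set
  IsClosedSAM k n S =
    Unique S × length S ≡ n × All (λ f → dim f ≡ k) S × Closed S × Connected S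

  translate : Vec ℤ d → Face d → Face d
  translate v (H , a) = (H , zipWith ℤ._+_ v a)

  TranslationEquiv : List (Face d) → List (Face d) → Set
  TranslationEquiv S S′ = ∃[ v ] (∀ f → (f ∈L S′) ⇔ (translate v f ∈L S))

module Submission where

-- Translate a closed manifold so that one of its faces, with direction set H, has
-- its lower corner at the origin, and rebuild the manifold from that face, one face
-- at a time. While the rebuilt part T is a proper subset, connectivity gives a face
-- f ∈ T with a facet g lying in no other face of T, and closedness gives a second
-- face of the manifold on g, necessarily outside T. Besides f, exactly 2(d − k) + 1
-- faces contain g, so an index in Fin (2(d − k) + 1) determines the new face once
-- the choice of (f , g) is made canonical. Hence H (one of C(d,k) subsets) and
-- n − 1 indices determine the manifold up to translation.

open import Defs
open import Data.Nat using (ℕ; zero; suc; _+_; _*_; _∸_; _^_; _≤_; _<_; z≤n; s≤s; s≤s⁻¹)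
open import Data.Nat.Properties
  using (≤-refl; ≤-reflexive; <⇒≱; +-comm; +-identityʳ; +-suc; *-comm; *-monoˡ-≤; m<m+n; m+[n∸m]≡n;
         suc-injective; module ≤-Reasoning)
open import Data.Nat.Combinatorics using (_C_; nCk+nC[k+1]≡[n+1]C[k+1])
open import Data.Bool using (Bool; true; false)
import Data.Bool.Properties as Bool
open import Data.Integer as ℤ using (ℤ; +_; 0ℤ)
import Data.Integer.Properties as ℤ
open import Data.Fin using (Fin; zero; suc)
import Data.Fin.Properties as Fin
open import Data.Fin.Subset using (Subset; inside; outside; _-_; ∁; ∣_∣)
  renaming (_∈_ to _∈ₛ_; _∉_ to _∉ₛ_)
open import Data.Fin.Subset.Properties using (p─⊥≡p; x∉p⇒x∈∁p; ∣∁p∣≡n∸∣p∣)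
open import Data.Vec as Vec
  using (Vec; []; _∷_; here; there; lookup; zipWith; replicate; _[_]≔_; _[_]%=_)
import Data.Vec.Properties as Vec
open import Data.Vec.Properties
  using (tabulate∘lookup; tabulate-cong; lookup∘updateAt; lookup∘updateAt′; lookup-zipWith;
         zipWith-assoc; zipWith-identityˡ; zipWith-inverseˡ; zipWith-inverseʳ)
open import Data.List
  using (List; []; _∷_; [_]; length; map; filter; _++_; cartesianProduct; cartesianProductWith; allFin)
open import Data.List.Properties using (length-++; length-map; length-tabulate; filter-notAll)
open import Data.List.Membership.Propositional using (_∈_; _∉_; find; lose)
open import Data.List.Membership.Propositional.Properties
  using (∈-map⁺; ∈-map⁻; ∈-++⁺ˡ; ∈-++⁺ʳ; ∈-filter⁺; ∈-allFin; ∈-cartesianProduct⁺;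
         ∈-cartesianProductWith⁺; ∈-cartesianProductWith⁻)
import Data.List.Membership.DecPropositional as DecMembership
open import Data.List.Relation.Unary.Any as Any using (Any; here; there)
open import Data.List.Relation.Unary.All as All using (All; []; _∷_)
open import Data.List.Relation.Unary.All.Properties using (¬All⇒Any¬; ¬Any⇒All¬)
  renaming (map⁺ to All-map⁺)
open import Data.List.Relation.Unary.AllPairs as AllPairs using (AllPairs; []; _∷_)
open import Data.List.Relation.Unary.Unique.Propositional using (Unique)
import Data.List.Relation.Unary.Unique.Propositional.Properties as Unique
open import Data.List.Relation.Binary.Subset.Propositional using (_⊆_)
open import Data.Product using (Σ-syntax; ∃-syntax; _×_; _,_)
import Data.Product.Properties as Product
open import Data.Sum as Sum using (_⊎_; inj₁; inj₂)
open import Function using (id; _∘_)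
open import Function.Bundles using (_⇔_; mk⇔)
import Function.Properties.Equivalence as ⇔
open import Relation.Nullary using (¬_; Dec; yes; no; ¬?; contradiction)
open import Relation.Nullary.Decidable using (_→-dec_; map′)
open import Relation.Binary.Definitions using (DecidableEquality)
open import Relation.Binary.PropositionalEquality using (_≡_; _≢_; refl; sym; trans; cong; cong₂; subst)

module _ {A : Set} (_≟_ : DecidableEquality A) where

  open DecMembership _≟_ using (_∈?_)

  without : A → List A → List A
  without x = filter (λ y → ¬? (y ≟ x))

  ∈-without⁺ : ∀ {x y xs} → y ∈ xs → y ≢ x → y ∈ without x xs
  ∈-without⁺ {x} = ∈-filter⁺ (λ y → ¬? (y ≟ x))

  length-without< : ∀ {x xs} → x ∈ xs → length (without x xs) < length xs
  length-without< {x} {xs} x∈xs =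
    filter-notAll (λ y → ¬? (y ≟ x)) xs (Any.map (λ x≡y y≢x → y≢x (sym x≡y)) x∈xs)

  pigeonhole : ∀ {X : Set} (R : X → A → Set) {xs : List X} {ys : List A} →
    All (λ x → ∃[ y ] (y ∈ ys × R x y)) xs →
    AllPairs (λ x x′ → ∀ {y} → R x y → ¬ R x′ y) xs →
    length xs ≤ length ys
  pigeonhole R [] [] = z≤n
  pigeonhole R {x ∷ xs} {ys} ((y , y∈ys , xRy) ∷ images) (disjoint ∷ disjoints) = begin-strict
    length xs             ≤⟨ pigeonhole R (All.zipWith avoid (images , disjoint)) disjoints ⟩
    length (without y ys) <⟨ length-without< y∈ys ⟩
    length ys             ∎
    where
    open ≤-Reasoning
    avoid : ∀ {x′} → (∃[ y′ ] (y′ ∈ ys × R x′ y′)) × (∀ {y} → R x y → ¬ R x′ y) →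
            ∃[ y′ ] (y′ ∈ without y ys × R x′ y′)
    avoid ((y′ , y′∈ys , x′Ry′) , disj) =
      y′ , ∈-without⁺ y′∈ys (λ { refl → disj xRy x′Ry′ }) , x′Ry′

  Unique⇒length≤ : ∀ {xs ys} → Unique xs → xs ⊆ ys → length xs ≤ length ys
  Unique⇒length≤ unique xs⊆ys =
    pigeonhole _≡_ (All.tabulate (λ {x} x∈xs → x , xs⊆ys x∈xs , refl))
      (AllPairs.map (λ x≢x′ → λ { refl refl → x≢x′ refl }) unique)

  length<⇒∃∉ : ∀ {xs ys} → Unique xs → length ys < length xs → ∃[ x ] (x ∈ xs × x ∉ ys)
  length<⇒∃∉ {xs} {ys} unique ys<xs with All.all? (_∈? ys) xs
  ... | yes xs⊆ys = contradiction (Unique⇒length≤ unique (All.lookup xs⊆ys)) (<⇒≱ ys<xs)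
  ... | no xs⊈ys = find (¬All⇒Any¬ (_∈? ys) xs xs⊈ys)

  ⊆∧length≤⇒⊇ : ∀ {xs ys} → Unique xs → xs ⊆ ys → length ys ≤ length xs → ys ⊆ xs
  ⊆∧length≤⇒⊇ {xs} {ys} unique xs⊆ys ys≤xs {y} y∈ys with y ∈? xs
  ... | yes y∈xs = y∈xs
  ... | no y∉xs =
    contradiction (Unique⇒length≤ (¬Any⇒All¬ xs y∉xs ∷ unique) y∷xs⊆ys) (<⇒≱ (s≤s ys≤xs))
    where
    y∷xs⊆ys : y ∷ xs ⊆ ys
    y∷xs⊆ys (here refl) = y∈ys
    y∷xs⊆ys (there x∈xs) = xs⊆ys x∈xs

lookupOr : ∀ {A : Set} {m} → A → List A → Fin m → A
lookupOr x [] i = x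
lookupOr x (y ∷ ys) zero = y
lookupOr x (y ∷ ys) (suc i) = lookupOr x ys i

∈⇒lookupOr : ∀ {A : Set} {m} (x : A) {y ys} → y ∈ ys → length ys ≤ m →
  ∃[ i ] (lookupOr {m = m} x ys i ≡ y)
∈⇒lookupOr {m = suc m} x (here refl) _ = zero , refl
∈⇒lookupOr {m = suc m} x (there y∈ys) (s≤s ys≤m) with ∈⇒lookupOr x y∈ys ys≤m
... | i , eq = suc i , eq

length-cartesianProductWith : ∀ {A B C : Set} (f : A → B → C) xs ys →
  length (cartesianProductWith f xs ys) ≡ length xs * length ys
length-cartesianProductWith f [] ys = refl
length-cartesianProductWith f (x ∷ xs) ys =
  trans (length-++ (map (f x) ys))
        (cong₂ _+_ (length-map (f x) ys) (length-cartesianProductWith f xs ys))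

m∸n≤1+m∸1+n : ∀ m n → m ∸ n ≤ suc (m ∸ suc n)
m∸n≤1+m∸1+n zero zero = z≤n
m∸n≤1+m∸1+n zero (suc n) = z≤n
m∸n≤1+m∸1+n (suc m) zero = ≤-refl
m∸n≤1+m∸1+n (suc m) (suc n) = m∸n≤1+m∸1+n m n

vectors : (m r : ℕ) → List (Vec (Fin m) r)
vectors m zero = [ [] ]
vectors m (suc r) = cartesianProductWith _∷_ (allFin m) (vectors m r)

length-vectors : ∀ m r → length (vectors m r) ≡ m ^ r
length-vectors m zero = refl
length-vectors m (suc r) =
  trans (length-cartesianProductWith _∷_ (allFin m) (vectors m r))
        (cong₂ _*_ (length-tabulate {n = m} id) (length-vectors m r))

∈-vectors : ∀ {m r} (v : Vec (Fin m) r) → v ∈ vectors m r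
∈-vectors [] = here refl
∈-vectors (i ∷ v) = ∈-cartesianProductWith⁺ _∷_ (∈-allFin i) (∈-vectors v)

subsetsOfSize : (n k : ℕ) → List (Subset n)
subsetsOfSize zero zero = [ [] ]
subsetsOfSize zero (suc k) = []
subsetsOfSize (suc n) zero = map (outside ∷_) (subsetsOfSize n zero)
subsetsOfSize (suc n) (suc k) =
  map (inside ∷_) (subsetsOfSize n k) ++ map (outside ∷_) (subsetsOfSize n (suc k))

length-subsetsOfSize : ∀ n k → length (subsetsOfSize n k) ≡ n C k
length-subsetsOfSize zero zero = refl
length-subsetsOfSize zero (suc k) = refl
length-subsetsOfSize (suc n) zero =
  trans (length-map _ (subsetsOfSize n zero)) (length-subsetsOfSize n zero)
length-subsetsOfSize (suc n) (suc k) =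
  trans (length-++ (map (inside ∷_) (subsetsOfSize n k)))
    (trans (cong₂ _+_ (trans (length-map _ (subsetsOfSize n k)) (length-subsetsOfSize n k))
                      (trans (length-map _ (subsetsOfSize n (suc k))) (length-subsetsOfSize n (suc k))))
           (nCk+nC[k+1]≡[n+1]C[k+1] n k))

∈-subsetsOfSize : ∀ {n} (p : Subset n) {k} → ∣ p ∣ ≡ k → p ∈ subsetsOfSize n k
∈-subsetsOfSize [] {zero} refl = here refl
∈-subsetsOfSize (inside ∷ p) {suc k} ∣p∣≡k =
  ∈-++⁺ˡ (∈-map⁺ _ (∈-subsetsOfSize p (suc-injective ∣p∣≡k)))
∈-subsetsOfSize (outside ∷ p) {zero} ∣p∣≡k = ∈-map⁺ _ (∈-subsetsOfSize p ∣p∣≡k)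
∈-subsetsOfSize {suc n} (outside ∷ p) {suc k} ∣p∣≡k =
  ∈-++⁺ʳ (map (inside ∷_) (subsetsOfSize n k)) (∈-map⁺ _ (∈-subsetsOfSize p ∣p∣≡k))

elements : ∀ {n} → Subset n → List (Fin n)
elements [] = []
elements (inside ∷ p) = zero ∷ map suc (elements p)
elements (outside ∷ p) = map suc (elements p)

length-elements : ∀ {n} (p : Subset n) → length (elements p) ≡ ∣ p ∣
length-elements [] = refl
length-elements (inside ∷ p) = cong suc (trans (length-map suc (elements p)) (length-elements p))
length-elements (outside ∷ p) = trans (length-map suc (elements p)) (length-elements p)

∈-elements⁺ : ∀ {n} {p : Subset n} {x} → x ∈ₛ p → x ∈ elements p
∈-elements⁺ here = here refl
∈-elements⁺ {p = inside ∷ _} (there x∈p) = there (∈-map⁺ suc (∈-elements⁺ x∈p))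
∈-elements⁺ {p = outside ∷ _} (there x∈p) = ∈-map⁺ suc (∈-elements⁺ x∈p)

∈-elements⁻ : ∀ {n} (p : Subset n) {x} → x ∈ elements p → x ∈ₛ p
∈-elements⁻ (inside ∷ p) (here refl) = here
∈-elements⁻ (inside ∷ p) (there x∈) with ∈-map⁻ suc x∈
... | _ , y∈ , refl = there (∈-elements⁻ p y∈)
∈-elements⁻ (outside ∷ p) x∈ with ∈-map⁻ suc x∈
... | _ , y∈ , refl = there (∈-elements⁻ p y∈)

x∈p⇒suc∣p-x∣≡∣p∣ : ∀ {n} {p : Subset n} {x} → x ∈ₛ p → suc ∣ p - x ∣ ≡ ∣ p ∣
x∈p⇒suc∣p-x∣≡∣p∣ {p = inside ∷ p} here = cong (λ q → suc ∣ q ∣) (p─⊥≡p p)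
x∈p⇒suc∣p-x∣≡∣p∣ {p = inside ∷ _} (there x∈p) = cong suc (x∈p⇒suc∣p-x∣≡∣p∣ x∈p)
x∈p⇒suc∣p-x∣≡∣p∣ {p = outside ∷ _} (there x∈p) = x∈p⇒suc∣p-x∣≡∣p∣ x∈p

x∉p-x : ∀ {n} {p : Subset n} {x} → x ∉ₛ p - x
x∉p-x {p = _ ∷ _} {zero} ()
x∉p-x {p = _ ∷ _} {suc x} (there x∈p-x) = x∉p-x x∈p-x

x∈p⇒p-x[x]≔inside≡p : ∀ {n} {p : Subset n} {x} → x ∈ₛ p → (p - x) [ x ]≔ inside ≡ p
x∈p⇒p-x[x]≔inside≡p {p = inside ∷ p} here = cong (inside ∷_) (p─⊥≡p p)
x∈p⇒p-x[x]≔inside≡p {p = b ∷ _} (there x∈p) = cong (b ∷_) (x∈p⇒p-x[x]≔inside≡p x∈p)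

lookup-ext : ∀ {A : Set} {n} {u v : Vec A n} → (∀ i → lookup u i ≡ lookup v i) → u ≡ v
lookup-ext {u = u} {v} eq =
  trans (sym (tabulate∘lookup u)) (trans (tabulate-cong eq) (tabulate∘lookup v))

≡-updateAt : ∀ {A : Set} {n} {u v : Vec A n} {j} {h : A → A} →
  (∀ i → i ≢ j → lookup u i ≡ lookup v i) → lookup u j ≡ h (lookup v j) → u ≡ v [ j ]%= h
≡-updateAt {u = u} {v} {j} {h} off at = lookup-ext agree
  where
  agree : ∀ i → lookup u i ≡ lookup (v [ j ]%= h) i
  agree i with i Fin.≟ j
  ... | yes refl = trans at (sym (lookup∘updateAt j v))
  ... | no i≢j = trans (off i i≢j) (sym (lookup∘updateAt′ i j i≢j v))

offset : Bool → ℤ → ℤ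
offset false = id
offset true = ℤ._+ + 1

unoffset : Bool → ℤ → ℤ
unoffset false = id
unoffset true = ℤ.pred

unoffset-offset : ∀ b z → unoffset b (offset b z) ≡ z
unoffset-offset false z = refl
unoffset-offset true z = trans (cong ℤ.pred (ℤ.+-comm z (+ 1))) (ℤ.pred-suc z)

offset-cases : ∀ b z → offset b z ≡ z ⊎ offset b z ≡ z ℤ.+ + 1
offset-cases false z = inj₁ refl
offset-cases true z = inj₂ refl

side⇒offset : ∀ {x z} → x ≡ z ⊎ x ≡ z ℤ.+ + 1 → ∃[ b ] (x ≡ offset b z)
side⇒offset (inj₁ x≡z) = false , x≡z
side⇒offset (inj₂ x≡z+1) = true , x≡z+1

bothSides : List Bool
bothSides = false ∷ true ∷ []

∈-bothSides : ∀ b → b ∈ bothSides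
∈-bothSides false = here refl
∈-bothSides true = there (here refl)

module _ {d : ℕ} where

  _≟F_ : DecidableEquality (Face d)
  _≟F_ = Product.≡-dec (Vec.≡-dec Bool._≟_) (Vec.≡-dec ℤ._≟_)

  -- For j ∈ H, facet (H , a) j b is the facet on the hyperplane x_j = a_j (b = false)
  -- or x_j = a_j + 1 (b = true); for j ∉ G, cofacet g j b is the face having g as
  -- that facet.
  facet : Face d → Fin d → Bool → Face d
  facet (H , a) j b = H - j , a [ j ]%= offset b

  cofacet : Face d → Fin d → Bool → Face d
  cofacet (G , c) j b = G [ j ]≔ inside , c [ j ]%= unoffset b

  facets : Face d → List (Face d)
  facets f@(H , _) = cartesianProductWith (facet f) (elements H) bothSides

  cofacets : Face d → List (Face d)
  cofacets g@(G , _) = cartesianProductWith (cofacet g) (elements (∁ G)) bothSides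

  facet-FacetOf : ∀ {H a j} → j ∈ₛ H → ∀ b → FacetOf (facet (H , a) j b) (H , a)
  facet-FacetOf {H} {a} {j} j∈H b =
    j , j∈H , refl , (λ i i≢j → lookup∘updateAt′ i j i≢j a) ,
    subst (λ x → x ≡ lookup a j ⊎ x ≡ lookup a j ℤ.+ + 1) (sym (lookup∘updateAt j a))
          (offset-cases b (lookup a j))

  FacetOf⇒facet : ∀ {G c H a} → FacetOf (G , c) (H , a) →
    ∃[ j ] ∃[ b ] (j ∈ₛ H × (G , c) ≡ facet (H , a) j b)
  FacetOf⇒facet {c = c} {a = a} (j , j∈H , refl , off , side) with side⇒offset side
  ... | b , cⱼ≡ = j , b , j∈H , cong (_ ,_) (≡-updateAt {u = c} {a} off cⱼ≡)

  FacetOf⇒cofacet : ∀ {G c H a} → FacetOf (G , c) (H , a) →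
    ∃[ j ] ∃[ b ] (j ∈ₛ ∁ G × (H , a) ≡ cofacet (G , c) j b)
  FacetOf⇒cofacet {c = c} {a = a} (j , j∈H , refl , off , side) with side⇒offset side
  ... | b , cⱼ≡ = j , b , x∉p⇒x∈∁p x∉p-x ,
    cong₂ _,_ (sym (x∈p⇒p-x[x]≔inside≡p j∈H))
      (≡-updateAt {u = a} {c} (λ i i≢j → sym (off i i≢j))
        (trans (sym (unoffset-offset b (lookup a j))) (cong (unoffset b) (sym cⱼ≡))))

  ∈-facets⁻ : ∀ {g f} → g ∈ facets f → FacetOf g f
  ∈-facets⁻ {f = H , a} g∈ with ∈-cartesianProductWith⁻ (facet (H , a)) (elements H) bothSides g∈
  ... | j , b , j∈H , _ , refl = facet-FacetOf {H} {a} (∈-elements⁻ H j∈H) b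

  ∈-facets⁺ : ∀ {g f} → FacetOf g f → g ∈ facets f
  ∈-facets⁺ {G , c} {H , a} g⊂f with FacetOf⇒facet {G} {c} {H} {a} g⊂f
  ... | j , b , j∈H , refl =
    ∈-cartesianProductWith⁺ (facet (H , a)) (∈-elements⁺ j∈H) (∈-bothSides b)

  ∈-cofacets⁺ : ∀ {g f} → FacetOf g f → f ∈ cofacets g
  ∈-cofacets⁺ {G , c} {H , a} g⊂f with FacetOf⇒cofacet {G} {c} {H} {a} g⊂f
  ... | j , b , j∈∁G , refl =
    ∈-cartesianProductWith⁺ (cofacet (G , c)) (∈-elements⁺ j∈∁G) (∈-bothSides b)

  facetOf? : ∀ g f → Dec (FacetOf g f)
  facetOf? g f = map′ ∈-facets⁻ ∈-facets⁺ (g ∈? facets f)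
    where open DecMembership _≟F_ using (_∈?_)

  length-cofacets : ∀ g → length (cofacets g) ≡ (d ∸ dim g) * 2
  length-cofacets g@(G , _) =
    trans (length-cartesianProductWith (cofacet g) (elements (∁ G)) bothSides)
          (cong (_* 2) (trans (length-elements (∁ G)) (∣∁p∣≡n∸∣p∣ G)))

  FacetOf⇒suc-dim : ∀ {g f : Face d} → FacetOf g f → suc (dim g) ≡ dim f
  FacetOf⇒suc-dim {G , c} {H , a} (_ , j∈H , refl , _) = x∈p⇒suc∣p-x∣≡∣p∣ j∈H

  length-otherCofacets≤ : ∀ {g f : Face d} {k} → FacetOf g f → dim f ≡ k →
    length (without _≟F_ f (cofacets g)) ≤ 2 * (d ∸ k) + 1
  length-otherCofacets≤ {g} {f} {k} g⊂f dim≡k = s≤s⁻¹ (begin-strict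
    length (without _≟F_ f (cofacets g)) <⟨ length-without< _≟F_ (∈-cofacets⁺ {g = g} {f} g⊂f) ⟩
    length (cofacets g)                  ≡⟨ length-cofacets g ⟩
    (d ∸ dim g) * 2                      ≤⟨ *-monoˡ-≤ 2 (m∸n≤1+m∸1+n d (dim g)) ⟩
    suc (d ∸ suc (dim g)) * 2            ≡⟨ cong (λ x → suc (d ∸ x) * 2) suc-dim-g≡k ⟩
    suc (d ∸ k) * 2                      ≡⟨ cong suc (trans (cong suc (*-comm (d ∸ k) 2))
                                                            (+-comm 1 (2 * (d ∸ k)))) ⟩
    suc (2 * (d ∸ k) + 1)                ∎)
    where
    open ≤-Reasoning
    suc-dim-g≡k : suc (dim g) ≡ k
    suc-dim-g≡k = trans (FacetOf⇒suc-dim {g = g} {f} g⊂f) dim≡k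

module _ {d : ℕ} where

  negate : Vec ℤ d → Vec ℤ d
  negate = Vec.map (ℤ.-_)

  translate-∘ : ∀ u v (f : Face d) → translate u (translate v f) ≡ translate (zipWith ℤ._+_ u v) f
  translate-∘ u v (H , a) = cong (H ,_) (sym (zipWith-assoc ℤ.+-assoc u v a))

  translate-0 : ∀ (f : Face d) → translate (replicate d 0ℤ) f ≡ f
  translate-0 (H , a) = cong (H ,_) (zipWith-identityˡ ℤ.+-identityˡ a)

  translate-inverseˡ : ∀ v (f : Face d) → translate (negate v) (translate v f) ≡ f
  translate-inverseˡ v f = trans (translate-∘ (negate v) v f)
    (trans (cong (λ w → translate w f) (zipWith-inverseˡ ℤ.+-inverseˡ v)) (translate-0 f))

  translate-inverseʳ : ∀ v (f : Face d) → translate v (translate (negate v) f) ≡ f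
  translate-inverseʳ v f = trans (translate-∘ v (negate v) f)
    (trans (cong (λ w → translate w f) (zipWith-inverseʳ ℤ.+-inverseʳ v)) (translate-0 f))

  translate-injective : ∀ v {f f′ : Face d} → translate v f ≡ translate v f′ → f ≡ f′
  translate-injective v {f} {f′} eq =
    trans (sym (translate-inverseˡ v f)) (trans (cong (translate (negate v)) eq) (translate-inverseˡ v f′))

  translate-negate-corner : ∀ H a → translate (negate a) (H , a) ≡ (H , replicate d 0ℤ)
  translate-negate-corner H a = cong (H ,_) (zipWith-inverseˡ ℤ.+-inverseˡ a)

  translate-FacetOf : ∀ v {g f : Face d} → FacetOf g f → FacetOf (translate v g) (translate v f)
  translate-FacetOf v {G , c} {H , a} (j , j∈H , G≡H-j , off , side) =
    j , j∈H , G≡H-j , (λ i i≢j → trans (shifted i (off i i≢j)) (unshifted i)) ,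
    Sum.map (λ cⱼ≡aⱼ → trans (shifted j cⱼ≡aⱼ) (unshifted j))
            (λ cⱼ≡aⱼ+1 → trans (shifted j cⱼ≡aⱼ+1)
              (trans (sym (ℤ.+-assoc (lookup v j) (lookup a j) (+ 1)))
                     (cong (λ x → x ℤ.+ + 1) (unshifted j))))
            side
    where
    shifted : ∀ i {x} → lookup c i ≡ x → lookup (zipWith ℤ._+_ v c) i ≡ lookup v i ℤ.+ x
    shifted i cᵢ≡x = trans (lookup-zipWith ℤ._+_ i v c) (cong (λ x → lookup v i ℤ.+ x) cᵢ≡x)
    unshifted : ∀ i → lookup v i ℤ.+ lookup a i ≡ lookup (zipWith ℤ._+_ v a) i
    unshifted i = sym (lookup-zipWith ℤ._+_ i v a)

  FacetOf-translate⁻ : ∀ w {g f : Face d} →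
    FacetOf g (translate w f) → FacetOf (translate (negate w) g) f
  FacetOf-translate⁻ w {g} {f} g⊂wf =
    subst (FacetOf (translate (negate w) g)) (translate-inverseˡ w f) (translate-FacetOf (negate w) g⊂wf)

  FacetOf-translate⁺ : ∀ w {g f : Face d} →
    FacetOf (translate (negate w) g) f → FacetOf g (translate w f)
  FacetOf-translate⁺ w {g} {f} g′⊂f =
    subst (λ h → FacetOf h (translate w f)) (translate-inverseʳ w g) (translate-FacetOf w g′⊂f)

  Closed-translate : ∀ w {S : List (Face d)} → Closed S → Closed (map (translate w) S)
  Closed-translate w {S} closed g (f , f∈wS , g⊂f) with ∈-map⁻ (translate w) f∈wS
  ... | y , y∈S , refl with closed (translate (negate w) g) (y , y∈S , FacetOf-translate⁻ w g⊂f)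
  ... | f₁ , f₂ , f₁∈S , f₂∈S , f₁≢f₂ , g⊂f₁ , g⊂f₂ , only =
    translate w f₁ , translate w f₂ , ∈-map⁺ _ f₁∈S , ∈-map⁺ _ f₂∈S , f₁≢f₂ ∘ translate-injective w ,
    FacetOf-translate⁺ w g⊂f₁ , FacetOf-translate⁺ w g⊂f₂ , only′
    where
    only′ : ∀ h → h ∈ map (translate w) S → FacetOf g h → h ≡ translate w f₁ ⊎ h ≡ translate w f₂
    only′ h h∈wS g⊂h with ∈-map⁻ (translate w) h∈wS
    ... | y′ , y′∈S , refl =
      Sum.map (cong (translate w)) (cong (translate w)) (only y′ y′∈S (FacetOf-translate⁻ w g⊂h))

  Path-translate : ∀ w {S : List (Face d)} {f f′} →
    Path S f f′ → Path (map (translate w) S) (translate w f) (translate w f′)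
  Path-translate w here = here
  Path-translate w (step h∈S (g , g⊂f , g⊂h) path) =
    step (∈-map⁺ _ h∈S) (translate w g , translate-FacetOf w g⊂f , translate-FacetOf w g⊂h)
         (Path-translate w path)

  Connected-translate : ∀ w {S : List (Face d)} → Connected S → Connected (map (translate w) S)
  Connected-translate w connected f f′ f∈wS f′∈wS
    with ∈-map⁻ (translate w) f∈wS | ∈-map⁻ (translate w) f′∈wS
  ... | y , y∈S , refl | y′ , y′∈S , refl = Path-translate w (connected y y′ y∈S y′∈S)

  IsClosedSAM-translate : ∀ w {k n} {S : List (Face d)} →
    IsClosedSAM k n S → IsClosedSAM k n (map (translate w) S)
  IsClosedSAM-translate w {S = S} (unique , length≡n , dims , closed , connected) =
    Unique.map⁺ (translate-injective w) unique ,
    trans (length-map (translate w) S) length≡n ,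
    All-map⁺ dims ,
    Closed-translate w closed ,
    Connected-translate w connected

  TranslationEquiv-≋ : ∀ {S S′ : List (Face d)} → (∀ f → f ∈ S′ ⇔ f ∈ S) → TranslationEquiv S S′
  TranslationEquiv-≋ {S} {S′} same =
    replicate d 0ℤ , λ f → subst (λ h → f ∈ S′ ⇔ h ∈ S) (sym (translate-0 f)) (same f)

  TranslationEquiv-map : ∀ w (S : List (Face d)) → TranslationEquiv S (map (translate w) S)
  TranslationEquiv-map w S = negate w , λ f → mk⇔ (to f) (from f)
    where
    to : ∀ f → f ∈ map (translate w) S → translate (negate w) f ∈ S
    to f f∈wS with ∈-map⁻ (translate w) f∈wS
    ... | y , y∈S , refl = subst (_∈ S) (sym (translate-inverseˡ w y)) y∈S
    from : ∀ f → translate (negate w) f ∈ S → f ∈ map (translate w) S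
    from f f′∈S = subst (_∈ map (translate w) S) (translate-inverseʳ w f) (∈-map⁺ (translate w) f′∈S)

  TranslationEquiv-sym : ∀ {S S′ : List (Face d)} → TranslationEquiv S S′ → TranslationEquiv S′ S
  TranslationEquiv-sym {S} {S′} (v , equiv) = negate v , λ f →
    ⇔.sym (subst (λ h → translate (negate v) f ∈ S′ ⇔ h ∈ S) (translate-inverseʳ v f)
                 (equiv (translate (negate v) f)))

  TranslationEquiv-trans : ∀ {S S′ S″ : List (Face d)} →
    TranslationEquiv S S′ → TranslationEquiv S′ S″ → TranslationEquiv S S″
  TranslationEquiv-trans {S} {S′} (v , equiv) (u , equiv′) = zipWith ℤ._+_ v u , λ f →
    ⇔.trans (equiv′ f) (subst (λ h → translate u f ∈ S′ ⇔ h ∈ S) (translate-∘ v u f) (equiv (translate u f)))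

module _ {d : ℕ} where

  Exposed : List (Face d) → Face d → Face d → Set
  Exposed T f g = All (λ h → FacetOf g h → h ≡ f) T

  HasExposedFacet : List (Face d) → Set
  HasExposedFacet T = Any (λ f → Any (Exposed T f) (facets f)) T

  hasExposedFacet? : ∀ T → Dec (HasExposedFacet T)
  hasExposedFacet? T =
    Any.any? (λ f → Any.any? (λ g → All.all? (λ h → facetOf? g h →-dec h ≟F f) T) (facets f)) T

  ExposedFacet : List (Face d) → Set
  ExposedFacet T = ∃[ f ] ∃[ g ] (f ∈ T × g ∈ facets f × Exposed T f g)

  exposedFacet : ∀ {T} → HasExposedFacet T → ExposedFacet T
  exposedFacet e with find e
  ... | f , f∈T , e′ with find e′
  ... | g , g∈facets , exposed = f , g , f∈T , g∈facets , exposed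

  cross : ∀ {m T} → Fin m → ExposedFacet T → Face d
  cross i (f , g , _) = lookupOr f (without _≟F_ f (cofacets g)) i

  -- The decision is an argument so that extendWith-grows can case on it; the no-case
  -- is junk, excluded by hasExposedFacet while a manifold is being rebuilt.
  extendWith : ∀ {m} → Fin m → (T : List (Face d)) → Dec (HasExposedFacet T) → List (Face d)
  extendWith i T (yes e) = cross i (exposedFacet e) ∷ T
  extendWith i T (no _) = T

  extend : ∀ {m} → Fin m → List (Face d) → List (Face d)
  extend i T = extendWith i T (hasExposedFacet? T)

  decode : ∀ {m r} → Vec (Fin m) r → List (Face d) → List (Face d)
  decode [] T = T
  decode (i ∷ is) T = decode is (extend i T)

module _ {d : ℕ} {S : List (Face d)} (closed : Closed S) where

  otherFace : ∀ {g f} → f ∈ S → FacetOf g f → ∃[ f′ ] (f′ ∈ S × f′ ≢ f × FacetOf g f′)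
  otherFace {g} {f} f∈S g⊂f with closed g (f , f∈S , g⊂f)
  ... | f₁ , f₂ , f₁∈S , f₂∈S , f₁≢f₂ , g⊂f₁ , g⊂f₂ , only with only f f∈S g⊂f
  ... | inj₁ refl = f₂ , f₂∈S , f₁≢f₂ ∘ sym , g⊂f₂
  ... | inj₂ refl = f₁ , f₁∈S , f₁≢f₂ , g⊂f₁

  onlyTwo : ∀ {g f f′ h} → f ∈ S → f′ ∈ S → f ≢ f′ → FacetOf g f → FacetOf g f′ →
    h ∈ S → FacetOf g h → h ≡ f ⊎ h ≡ f′
  onlyTwo {g} {f} {f′} {h} f∈S f′∈S f≢f′ g⊂f g⊂f′ h∈S g⊂h with closed g (f , f∈S , g⊂f)
  ... | _ , _ , _ , _ , _ , _ , _ , only with only f f∈S g⊂f | only f′ f′∈S g⊂f′ | only h h∈S g⊂h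
  ... | inj₁ refl | inj₁ refl | _ = contradiction refl f≢f′
  ... | inj₂ refl | inj₂ refl | _ = contradiction refl f≢f′
  ... | inj₁ refl | inj₂ refl | inj₁ refl = inj₁ refl
  ... | inj₁ refl | inj₂ refl | inj₂ refl = inj₂ refl
  ... | inj₂ refl | inj₁ refl | inj₁ refl = inj₂ refl
  ... | inj₂ refl | inj₁ refl | inj₂ refl = inj₁ refl

module _ {d : ℕ} where

  open DecMembership (_≟F_ {d}) using (_∈?_)

  Path-exit : ∀ {S T : List (Face d)} {a b} → Path S a b → a ∈ T → b ∉ T →
    ∃[ f ] ∃[ f′ ] (f ∈ T × f′ ∈ S × f′ ∉ T × Adjacent f f′)
  Path-exit here a∈T b∉T = contradiction a∈T b∉T
  Path-exit {T = T} {a} (step {f′ = f′} f′∈S a~f′ path) a∈T b∉T with f′ ∈? T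
  ... | yes f′∈T = Path-exit path f′∈T b∉T
  ... | no f′∉T = a , f′ , a∈T , f′∈S , f′∉T , a~f′

  hasExposedFacet : ∀ {S T : List (Face d)} {f₀} → Unique S → Closed S → Connected S →
    T ⊆ S → f₀ ∈ T → length T < length S → HasExposedFacet T
  hasExposedFacet {S} {T} {f₀} uniqueS closed connected T⊆S f₀∈T T<S
    with length<⇒∃∉ _≟F_ uniqueS T<S
  ... | x , x∈S , x∉T with Path-exit (connected f₀ x (T⊆S f₀∈T) x∈S) f₀∈T x∉T
  ... | f , f′ , f∈T , f′∈S , f′∉T , g , g⊂f , g⊂f′ =
    lose f∈T (lose (∈-facets⁺ {g = g} {f} g⊂f) (All.tabulate exposed))
    where
    exposed : ∀ {h} → h ∈ T → FacetOf g h → h ≡ f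
    exposed {h} h∈T g⊂h
      with onlyTwo closed {g} {f} {f′} {h} (T⊆S f∈T) f′∈S (λ { refl → f′∉T f∈T }) g⊂f g⊂f′ (T⊆S h∈T) g⊂h
    ... | inj₁ h≡f = h≡f
    ... | inj₂ refl = contradiction h∈T f′∉T

  cross-grows : ∀ {k} {S T : List (Face d)} → Closed S → All (λ f → dim f ≡ k) S → T ⊆ S →
    (x : ExposedFacet T) → ∃[ i ] (cross {m = 2 * (d ∸ k) + 1} i x ∈ S × cross i x ∉ T)
  cross-grows closed dims T⊆S (f , g , f∈T , g∈facets , exposed) with ∈-facets⁻ {g = g} {f} g∈facets
  ... | g⊂f with otherFace closed {g} {f} (T⊆S f∈T) g⊂f
  ... | f′ , f′∈S , f′≢f , g⊂f′
    with ∈⇒lookupOr f (∈-without⁺ _≟F_ (∈-cofacets⁺ {g = g} {f′} g⊂f′) f′≢f)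
           (length-otherCofacets≤ {g = g} {f} g⊂f (All.lookup dims (T⊆S f∈T)))
  ... | i , refl = i , f′∈S , λ f′∈T → f′≢f (All.lookup exposed f′∈T g⊂f′)

  extendWith-grows : ∀ {k} {S T : List (Face d)} → Closed S → All (λ f → dim f ≡ k) S → T ⊆ S →
    HasExposedFacet T → (e? : Dec (HasExposedFacet T)) →
    ∃[ i ] ∃[ f′ ] (extendWith {m = 2 * (d ∸ k) + 1} i T e? ≡ f′ ∷ T × f′ ∈ S × f′ ∉ T)
  extendWith-grows closed dims T⊆S e (no ¬e) = contradiction e ¬e
  extendWith-grows closed dims T⊆S _ (yes e) with cross-grows closed dims T⊆S (exposedFacet e)
  ... | i , new∈S , new∉T = i , _ , refl , new∈S , new∉T

  FullSublistOf : List (Face d) → ℕ → List (Face d) → Set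
  FullSublistOf S n U = Unique U × U ⊆ S × length U ≡ n

  grow : ∀ {k n} {S : List (Face d)} → IsClosedSAM k n S → ∀ r (T : List (Face d)) {f₀} →
    Unique T → T ⊆ S → f₀ ∈ T → length T + r ≡ n →
    Σ[ is ∈ Vec (Fin (2 * (d ∸ k) + 1)) r ] FullSublistOf S n (decode is T)
  grow sam zero T uniqueT T⊆S f₀∈T T+0≡n =
    [] , uniqueT , T⊆S , trans (sym (+-identityʳ (length T))) T+0≡n
  grow {n = n} {S} sam@(uniqueS , length≡n , dims , closed , connected) (suc r) T uniqueT T⊆S f₀∈T T+r+1≡n
    with extendWith-grows closed dims T⊆S (hasExposedFacet uniqueS closed connected T⊆S f₀∈T T<S)
                          (hasExposedFacet? T)
    where
    T<S : length T < length S
    T<S = subst (length T <_) (trans T+r+1≡n (sym length≡n)) (m<m+n (length T) (s≤s z≤n))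
  ... | i , f′ , extended , f′∈S , f′∉T
    with grow sam r (f′ ∷ T) (¬Any⇒All¬ T f′∉T ∷ uniqueT) f′∷T⊆S (there f₀∈T)
              (trans (sym (+-suc (length T) r)) T+r+1≡n)
    where
    f′∷T⊆S : f′ ∷ T ⊆ S
    f′∷T⊆S (here refl) = f′∈S
    f′∷T⊆S (there h∈T) = T⊆S h∈T
  ... | is , full = i ∷ is , subst (λ U → FullSublistOf S n (decode is U)) (sym extended) full

  decode-covers : ∀ {k n} {S : List (Face d)} {f₀} → IsClosedSAM k n S → f₀ ∈ S → 1 ≤ n →
    Σ[ is ∈ Vec (Fin (2 * (d ∸ k) + 1)) (n ∸ 1) ] (∀ f → f ∈ decode is [ f₀ ] ⇔ f ∈ S)
  decode-covers {n = n} sam@(_ , length≡n , _) f₀∈S 1≤n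
    with grow sam (n ∸ 1) [ _ ] ([] ∷ []) (λ { (here refl) → f₀∈S }) (here refl) (m+[n∸m]≡n 1≤n)
  ... | is , unique , U⊆S , length≡n′ =
    is , λ f → mk⇔ U⊆S (⊆∧length≤⇒⊇ _≟F_ unique U⊆S (≤-reflexive (trans length≡n (sym length≡n′))))

Code : (d m r : ℕ) → Set
Code d m r = Subset d × Vec (Fin m) r

_≟Code_ : ∀ {d m r} → DecidableEquality (Code d m r)
_≟Code_ = Product.≡-dec (Vec.≡-dec Bool._≟_) (Vec.≡-dec Fin._≟_)

decodeCode : ∀ {d m r} → Code d m r → List (Face d)
decodeCode {d} (H , is) = decode is [ H , replicate d 0ℤ ]

codes : (d k n : ℕ) → List (Code d (2 * (d ∸ k) + 1) (n ∸ 1))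
codes d k n = cartesianProduct (subsetsOfSize d k) (vectors (2 * (d ∸ k) + 1) (n ∸ 1))

length-codes : ∀ d k n → length (codes d k n) ≡ (d C k) * (2 * (d ∸ k) + 1) ^ (n ∸ 1)
length-codes d k n =
  trans (length-cartesianProductWith _,_ (subsetsOfSize d k) (vectors _ (n ∸ 1)))
        (cong₂ _*_ (length-subsetsOfSize d k) (length-vectors _ (n ∸ 1)))

encode : ∀ {d k n} {S : List (Face d)} → 1 ≤ n → IsClosedSAM k n S →
  ∃[ c ] (c ∈ codes d k n × TranslationEquiv S (decodeCode c))
encode {S = []} (s≤s _) (_ , () , _)
encode {S = S@((H , a) ∷ _)} 1≤n sam@(_ , _ , dimH ∷ _ , _)
  with decode-covers (IsClosedSAM-translate (negate a) sam) (here (sym (translate-negate-corner H a))) 1≤n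
... | is , covers =
  (H , is) , ∈-cartesianProduct⁺ (∈-subsetsOfSize H dimH) (∈-vectors is) ,
  TranslationEquiv-trans (TranslationEquiv-map (negate a) S) (TranslationEquiv-≋ covers)

mainTheorem12 : (d k n : ℕ) → 1 ≤ k → k ≤ d → 1 ≤ n →
    (L : List (List (Face d))) →
    All (IsClosedSAM k n) L →
    AllPairs (λ S S′ → ¬ TranslationEquiv S S′) L →
    length L ≤ (d C k) * (2 * (d ∸ k) + 1) ^ (n ∸ 1)
mainTheorem12 d k n _ _ 1≤n L sams inequivalent = begin
  length L                              ≤⟨ pigeonhole _≟Code_ (λ S c → TranslationEquiv S (decodeCode c))
                                             (All.map (encode 1≤n) sams)
                                             (AllPairs.map distinctCodes inequivalent) ⟩
  length (codes d k n)                  ≡⟨ length-codes d k n ⟩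
  (d C k) * (2 * (d ∸ k) + 1) ^ (n ∸ 1) ∎
  where
  open ≤-Reasoning
  distinctCodes : ∀ {S S′} → ¬ TranslationEquiv S S′ → ∀ {c : Code d (2 * (d ∸ k) + 1) (n ∸ 1)} →
    TranslationEquiv S (decodeCode c) → ¬ TranslationEquiv S′ (decodeCode c)
  distinctCodes S≁S′ S≈c S′≈c = S≁S′ (TranslationEquiv-trans S≈c (TranslationEquiv-sym S′≈c))
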